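{- Let $G$ be a connected graph with at least two vertices, and let $G'$ be the graph with $V(G') = V(G) \cup \{v' : v \in V(G)\}$ (where each $v'$ is a new vertex) and $E(G') = E(G) \cup \{\{u,v'\},\{u',v\},\{u',v'\} : \{u,v\} \in E(G)\}$. Then $\operatorname{tcpw}(G') \leq \operatorname{pw}(G)$.
   Context: Two vertices $u,v$ are twins if $N(u)\setminus\{v\} = N(v)\setminus\{u\}$; $\Pi_{tc}(H)$ is the partition of $V(H)$ into twinclasses; the quotient graph $H/\Pi_{tc}(H)$ has the twinclasses as vertices, adjacent iff some of their vertices are adjacent. $\operatorname{tcpw}(H) = \operatorname{pw}(H/\Pi_{tc}(H))$, with $\operatorname{pw}$ denoting pathwidth. -}

module Defs where

open import Data.Nat using (ℕ; suc; _+_; _≤_)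
open import Data.Fin using (Fin; splitAt) renaming (_≤_ to _≤ᶠ_)
open import Data.Fin.Subset using (Subset; _∈_; ∣_∣)
open import Data.Sum using ([_,_])
open import Data.Product using (Σ; ∃; ∃₂; _×_)
open import Function using (id; _∘_)
open import Relation.Nullary using (¬_)
open import Relation.Binary.PropositionalEquality using (_≡_; _≢_)

record Graph : Set₁ where
  field
    n      : ℕ
    Adj    : Fin n → Fin n → Set
    sym    : ∀ {u v} → Adj u v → Adj v u
    irrefl : ∀ {u} → ¬ Adj u u
open Graph public

data Reach (G : Graph) : Fin (n G) → Fin (n G) → Set where
  here : ∀ {u} → Reach G u u
  step : ∀ {u w v} → Adj G u w → Reach G w v → Reach G u v

Connected : Graph → Set
Connected G = ∀ u v → Reach G u v

-- u,v twins : N(u) \ {v} = N(v) \ {u}  (Adj irreflexive, so only w ∉ {u,v} matter)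
Twins : (G : Graph) → Fin (n G) → Fin (n G) → Set
Twins G u v = ∀ w → w ≢ u → w ≢ v → (Adj G u w → Adj G v w) × (Adj G v w → Adj G u w)

-- Q together with f : V(G) → V(Q) is (a copy of) the quotient graph G / Π_tc(G):
-- f is surjective, its fibres are exactly the twinclasses, and two distinct classes
-- are adjacent iff some of their vertices are adjacent.
record IsTwinQuotient (G Q : Graph) (f : Fin (n G) → Fin (n Q)) : Set where
  field
    surj     : ∀ a → ∃ λ u → f u ≡ a
    fib→twin : ∀ u v → f u ≡ f v → Twins G u v
    twin→fib : ∀ u v → Twins G u v → f u ≡ f v
    adj→     : ∀ a b → Adj Q a b →
                 (a ≢ b) × ∃₂ λ u v → f u ≡ a × f v ≡ b × Adj G u v
    →adj     : ∀ a b → a ≢ b → ∀ u v → f u ≡ a → f v ≡ b → Adj G u v → Adj Q a b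

record PathDecomposition (G : Graph) (k : ℕ) : Set where
  field
    len    : ℕ
    bag    : Fin len → Subset (n G)
    cover  : ∀ v → ∃ λ i → v ∈ bag i
    edges  : ∀ u v → Adj G u v → ∃ λ i → u ∈ bag i × v ∈ bag i
    contig : ∀ v i j l → i ≤ᶠ j → j ≤ᶠ l → v ∈ bag i → v ∈ bag l → v ∈ bag j
    width  : ∀ i → ∣ bag i ∣ ≤ suc k

Pathwidth : Graph → ℕ → Set
Pathwidth G p = PathDecomposition G p × (∀ k → PathDecomposition G k → p ≤ k)

TwinclassPathwidth : Graph → ℕ → Set₁
TwinclassPathwidth H q =
  Σ Graph λ Q → Σ (Fin (n H) → Fin (n Q)) λ f → IsTwinQuotient H Q f × Pathwidth Q q

-- G': vertices Fin (n + n), first copy = V(G), second copy = {v'}.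
-- x,y adjacent iff their underlying vertices of G are adjacent; this gives exactly
-- E(G) ∪ {uv', u'v, u'v' : uv ∈ E(G)}.
orig : ∀ {n} → Fin (n + n) → Fin n
orig {n} = [ id , id ] ∘ splitAt n

double : Graph → Graph
double G = record
  { n = n G + n G
  ; Adj = λ x y → Adj G (orig x) (orig y)
  ; sym = sym G
  ; irrefl = irrefl G
  }

-- In G' every vertex v has the same neighbourhood as its copy v', so v and v' are twins.
-- Choosing a representative of each twinclass and mapping it to its vertex of G is
-- therefore injective, and adjacent twinclasses map to adjacent vertices: the quotient
-- G'/Π_tc(G') is isomorphic to a subgraph of G. Pulling a path decomposition of G back
-- along this embedding keeps its width, so tcpw(G') ≤ pw(G). Connectivity and
-- |V(G)| ≥ 2 are only needed for the reverse inequality.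
module Submission where

open import Defs
open import Data.Nat using (ℕ; _≤_; z≤n; s≤s)
open import Data.Nat.Properties using (≤-trans)
open import Data.Fin using (Fin; zero; suc)
open import Data.Fin.Properties using (suc-injective)
open import Data.Fin.Subset using (Subset; inside; outside; _-_; _⊆_) renaming (_∈_ to _∈ˢ_; ∣_∣ to card)
open import Data.Fin.Subset.Properties using (x∈p∧x≢y⇒x∈p-y; x∈p⇒∣p-x∣<∣p∣; p⊆q⇒∣p∣≤∣q∣)
open import Data.Vec using (tabulate; lookup)
open import Data.Vec.Properties using ([]=⇒lookup; lookup⇒[]=; lookup∘tabulate)
open import Data.Product using (proj₁; proj₂; _,_)
open import Function using (_∘_)
open import Function.Definitions using (Injective)
open import Relation.Binary.PropositionalEquality
  using (_≡_; _≢_; trans; cong; subst; module ≡-Reasoning) renaming (sym to ≡-sym)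

preimage : ∀ {m n} → (Fin m → Fin n) → Subset n → Subset m
preimage r S = tabulate (λ a → lookup S (r a))

module _ {m n} (r : Fin m → Fin n) (S : Subset n) where

  ∈-preimage⁻ : ∀ {a} → a ∈ˢ preimage r S → r a ∈ˢ S
  ∈-preimage⁻ {a} a∈ =
    lookup⇒[]= (r a) S (trans (≡-sym (lookup∘tabulate _ a)) ([]=⇒lookup a∈))

  ∈-preimage⁺ : ∀ {a} → r a ∈ˢ S → a ∈ˢ preimage r S
  ∈-preimage⁺ {a} ra∈ =
    lookup⇒[]= a (preimage r S) (trans (lookup∘tabulate _ a) ([]=⇒lookup ra∈))

card-preimage-injective : ∀ {m n} (r : Fin m → Fin n) → Injective _≡_ _≡_ r →
  ∀ S → card (preimage r S) ≤ card S
card-preimage-injective {ℕ.zero} r _ S = z≤n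
card-preimage-injective {ℕ.suc m} r r-inj S with lookup S (r zero) in r₀∈S
... | outside = card-preimage-injective (r ∘ suc) (suc-injective ∘ r-inj) S
... | inside  = ≤-trans
  (s≤s (≤-trans (p⊆q⇒∣p∣≤∣q∣ avoids-r₀)
                (card-preimage-injective (r ∘ suc) (suc-injective ∘ r-inj) (S - r zero))))
  (x∈p⇒∣p-x∣<∣p∣ (lookup⇒[]= (r zero) S r₀∈S))
  where
  avoids-r₀ : preimage (r ∘ suc) S ⊆ preimage (r ∘ suc) (S - r zero)
  avoids-r₀ a∈ = ∈-preimage⁺ (r ∘ suc) (S - r zero)
    (x∈p∧x≢y⇒x∈p-y (∈-preimage⁻ (r ∘ suc) S a∈) (λ e → 0≢1+n (≡-sym (r-inj e))))
    where
    0≢1+n : ∀ {k} {i : Fin k} → zero ≢ suc i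
    0≢1+n ()

pullback : ∀ {G Q k} (r : Fin (n Q) → Fin (n G)) →
  (∀ {a b} → Adj Q a b → Adj G (r a) (r b)) → Injective _≡_ _≡_ r →
  PathDecomposition G k → PathDecomposition Q k
pullback {G} {Q} r r-hom r-inj D = record
  { len    = len
  ; bag    = λ i → preimage r (bag i)
  ; cover  = λ a → let (i , ra∈) = cover (r a) in i , ∈-preimage⁺ r (bag i) ra∈
  ; edges  = λ a b a~b → let (i , ra∈ , rb∈) = edges (r a) (r b) (r-hom a~b)
                          in i , ∈-preimage⁺ r (bag i) ra∈ , ∈-preimage⁺ r (bag i) rb∈
  ; contig = λ a i j l i≤j j≤l a∈i a∈l → ∈-preimage⁺ r (bag j)
      (contig (r a) i j l i≤j j≤l (∈-preimage⁻ r (bag i) a∈i) (∈-preimage⁻ r (bag l) a∈l))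
  ; width  = λ i → ≤-trans (card-preimage-injective r r-inj (bag i)) (width i)
  }
  where open PathDecomposition D

module _ {H Q : Graph} {f : Fin (n H) → Fin (n Q)} (T : IsTwinQuotient H Q f) where
  open IsTwinQuotient T

  -- Two twin transfers: first from x to u (keeping y), then from y to v (keeping u).
  twinQuotient-adj⇒adj : ∀ {a b u v} → Adj Q a b → f u ≡ a → f v ≡ b → Adj H u v
  twinQuotient-adj⇒adj {a} {b} {u} {v} a~b fu fv with adj→ a b a~b
  ... | a≢b , x , y , fx , fy , x~y = Graph.sym H v~u
    where
    y≢u : y ≢ u
    y≢u y≡u = a≢b (trans (≡-sym fu) (trans (cong f (≡-sym y≡u)) fy))
    y≢x : y ≢ x
    y≢x y≡x = irrefl H (subst (Adj H x) y≡x x~y)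
    u~y : Adj H u y
    u~y = proj₂ (fib→twin u x (trans fu (≡-sym fx)) y y≢u y≢x) x~y
    u≢v : u ≢ v
    u≢v u≡v = a≢b (trans (≡-sym fu) (trans (cong f u≡v) fv))
    v~u : Adj H v u
    v~u = proj₂ (fib→twin v y (trans fv (≡-sym fy)) u u≢v (y≢u ∘ ≡-sym)) (Graph.sym H u~y)

  representative : Fin (n Q) → Fin (n H)
  representative a = proj₁ (surj a)

  representative-adj : ∀ {a b} → Adj Q a b → Adj H (representative a) (representative b)
  representative-adj {a} {b} a~b = twinQuotient-adj⇒adj a~b (proj₂ (surj a)) (proj₂ (surj b))

same-orig⇒twins : ∀ G (x y : Fin (n (double G))) → orig x ≡ orig y → Twins (double G) x y
same-orig⇒twins G x y ox≡oy w _ _ = subst (λ z → Adj G z (orig w)) ox≡oy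
                                  , subst (λ z → Adj G z (orig w)) (≡-sym ox≡oy)

module _ (G : Graph) {Q : Graph} {f : Fin (n (double G)) → Fin (n Q)}
         (T : IsTwinQuotient (double G) Q f) where
  open IsTwinQuotient T

  embedding : Fin (n Q) → Fin (n G)
  embedding = orig ∘ representative T

  embedding-injective : Injective _≡_ _≡_ embedding
  embedding-injective {a} {b} e = begin
    a                         ≡⟨ ≡-sym (proj₂ (surj a)) ⟩
    f (representative T a)    ≡⟨ twin→fib _ _ (same-orig⇒twins G _ _ e) ⟩
    f (representative T b)    ≡⟨ proj₂ (surj b) ⟩
    b                         ∎
    where open ≡-Reasoning

  embedding-adj : ∀ {a b} → Adj Q a b → Adj G (embedding a) (embedding b)
  embedding-adj = representative-adj T

lemma8p1 : (G : Graph) → Connected G → 2 ≤ n G →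
    ∀ p q → Pathwidth G p → TwinclassPathwidth (double G) q → q ≤ p
lemma8p1 G _ _ p q (D , _) (Q , f , T , (_ , q-minimal)) =
  q-minimal p (pullback (embedding G T) (embedding-adj G T) (embedding-injective G T) D)
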